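{- Let $r\ge 1$ and $i\ge 1$ be integers, and suppose $\delta_r(i-1)>0$. Then \[ d_{r+1}(p_{i+1})>d_{r+1}(p_i) \iff R_r(i-1)>g_i+1. \] Consequently, if $R_r(i-1)<g_i+1$, then $d_{r+1}(p_{i+1})<d_{r+1}(p_i)$.
   Context: Let $p_1=2<p_2=3<p_3=5<\cdots$ be the primes in increasing order and $g_i:=p_{i+1}-p_i$. For a positive integer $k$ and a prime $p$, $d_k(p)$ denotes the natural density of the set of positive integers $n$ for which $p$ is the $k$-th smallest prime divisor of $n$. For integers $m\ge0$ and $i\ge 0$, $\delta_m(i)$ denotes the natural density of the set of integers $n$ divisible by exactly $m$ primes from $\{p_1,\dots,p_i\}$ (so $\delta_0(0)=1$ and $\delta_m(0)=0$ for $m>0$). For $r\ge1$, $R_r(i):=\delta_{r-1}(i)/\delta_r(i)$ whenever $\delta_r(i)>0$. -}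

module Defs where

open import Data.Bool using (Bool; true; false; _∧_)
open import Data.Nat using (ℕ; zero; suc; _≤_; _<_; _∸_; _≡ᵇ_; _<ᵇ_)
open import Data.Nat.Divisibility using (_∣?_)
open import Data.Nat.Primality using (Prime; prime?)
open import Data.List using (List; length; filterᵇ; upTo; map)
open import Data.Integer using (+_)
open import Data.Rational using (ℚ; _/_; ∣_∣; _-_) renaming (_<_ to _<ℚ_)
open import Data.Product using (_×_; ∃-syntax)
open import Relation.Nullary using (does)
open import Relation.Binary.PropositionalEquality using (_≡_)

primeCount : ℕ → ℕ
primeCount n = length (filterᵇ (λ q → does (prime? q)) (upTo n))

-- p is the i-th prime p_i (1-indexed: p_1 = 2)
IsNthPrime : ℕ → ℕ → Set
IsNthPrime i p = Prime p × primeCount p ≡ i ∸ 1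

primeDivCountBelow : ℕ → ℕ → ℕ
primeDivCountBelow B n =
  length (filterᵇ (λ q → does (prime? q) ∧ does (q ∣? n)) (upTo B))

-- indicator: p is the k-th smallest prime divisor of n  (k ≥ 1)
kthPrimeDiv : ℕ → ℕ → ℕ → Bool
kthPrimeDiv k p n = does (prime? p) ∧ does (p ∣? n) ∧ (primeDivCountBelow p n ≡ᵇ (k ∸ 1))

-- indicator: n (≥ 1) is divisible by exactly m primes from {p_1,…,p_i}
-- (a prime divisor q of n ≥ 1 satisfies q ≤ n, so searching q < n+1 suffices;
--  q is among p_1..p_i iff primeCount q < i)
exactlyAmongFirst : ℕ → ℕ → ℕ → Bool
exactlyAmongFirst m i n =
  length (filterᵇ (λ q → does (prime? q) ∧ (primeCount q <ᵇ i) ∧ does (q ∣? n)) (upTo (suc n))) ≡ᵇ m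

countUpTo : (ℕ → Bool) → ℕ → ℕ
countUpTo f x = length (filterᵇ f (map suc (upTo x)))

HasDensity : (ℕ → Bool) → ℚ → Set
HasDensity f d =
  ∀ (ε : ℚ) → 0ℚ' <ℚ ε → ∃[ N ] (∀ (y : ℕ) → N ≤ y →
     ∣ ((+ countUpTo f (suc y)) / suc y) - d ∣ <ℚ ε)
  where
  0ℚ' : ℚ
  0ℚ' = + 0 / 1

-- Let D_P(n) be the number of primes below P dividing n, and p = p_i, q = p_{i+1}.
-- Since D_p(p k) = D_p(k), the n ≤ p m having p as (r+1)-th smallest prime divisor are the
-- n = p k with D_p(k) = r; as primes below p are p_1, …, p_{i-1}, this gives
-- d_{r+1}(p) · p = δ_r(i-1).  No prime lies strictly between p and q, so
-- D_q(n) = D_p(n) + [p ∣ n]; sorting n ≤ p m with D_q(n) = r by divisibility by p yields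
-- the exact count identity behind d_{r+1}(q) · q p + δ_r(i-1) = δ_r(i-1) · p + δ_{r-1}(i-1).
-- Both identities pass to densities along the subsequences n = p m and n = q p m, and
-- eliminating gives (d_{r+1}(q) - d_{r+1}(p)) · q p = (R_r(i-1) - (g_i + 1)) · δ_r(i-1).
{-# OPTIONS --safe #-}
module Submission where

open import Defs

module Counting where

  open import Data.Bool using (Bool; true; false; _∧_; not)
  open import Data.Bool.Properties using (∧-zeroʳ; ∧-identityʳ)
  open import Data.Empty using (⊥; ⊥-elim)
  open import Data.List using ([]; _∷_; _∷ʳ_; _++_; [_]; length; filterᵇ; upTo; map)
  open import Data.List.Properties using (upTo-∷ʳ; filter-++; length-++)
  open import Data.Nat
  open import Data.Nat.Properties
  open import Data.Nat.Coprimality using (coprime-divisor; prime⇒coprime) renaming (sym to coprime-sym)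
  open import Data.Nat.Divisibility using (_∣_; divides; _∣?_; ∣⇒≤; m∣m*n; ∣n⇒∣m*n)
  open import Data.Nat.Primality using (Prime; prime?; prime⇒nonZero)
  open import Data.Sum using (inj₁; inj₂)
  open import Algebra.Properties.CommutativeSemigroup +-commutativeSemigroup using (interchange; xy∙z≈xz∙y)
  open import Function using (_∘_)
  open import Function.Bundles using (_⇔_; mk⇔; Equivalence)
  open import Relation.Nullary using (¬_; does; yes; no)
  open import Relation.Nullary.Decidable using (T?; dec-true; dec-false; does-⇔)
  open import Relation.Binary.PropositionalEquality
    using (_≡_; refl; sym; trans; cong; cong₂; subst; subst₂; module ≡-Reasoning)

  indicator : Bool → ℕ
  indicator true  = 1
  indicator false = 0

  countBelow : (ℕ → Bool) → ℕ → ℕ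
  countBelow P n = length (filterᵇ P (upTo n))

  length-filterᵇ-singleton : ∀ (P : ℕ → Bool) x → length (filterᵇ P [ x ]) ≡ indicator (P x)
  length-filterᵇ-singleton P x with P x
  ... | true  = refl
  ... | false = refl

  length-filterᵇ-∷ʳ : ∀ (P : ℕ → Bool) xs x →
    length (filterᵇ P (xs ∷ʳ x)) ≡ length (filterᵇ P xs) + indicator (P x)
  length-filterᵇ-∷ʳ P xs x = begin
    length (filterᵇ P (xs ++ [ x ]))                 ≡⟨ cong length (filter-++ (T? ∘ P) xs [ x ]) ⟩
    length (filterᵇ P xs ++ filterᵇ P [ x ])         ≡⟨ length-++ (filterᵇ P xs) ⟩
    length (filterᵇ P xs) + length (filterᵇ P [ x ]) ≡⟨ cong (length (filterᵇ P xs) +_) (length-filterᵇ-singleton P x) ⟩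
    length (filterᵇ P xs) + indicator (P x)          ∎
    where open ≡-Reasoning

  countBelow-suc : ∀ P n → countBelow P (suc n) ≡ countBelow P n + indicator (P n)
  countBelow-suc P n = begin
    length (filterᵇ P (upTo (suc n)))  ≡⟨ cong (length ∘ filterᵇ P) (upTo-∷ʳ n) ⟨
    length (filterᵇ P (upTo n ∷ʳ n))   ≡⟨ length-filterᵇ-∷ʳ P (upTo n) n ⟩
    countBelow P n + indicator (P n)   ∎
    where open ≡-Reasoning

  countBelow-cong : ∀ {P Q} n → (∀ k → k < n → P k ≡ Q k) → countBelow P n ≡ countBelow Q n
  countBelow-cong zero    _     = refl
  countBelow-cong {P} {Q} (suc n) P≡Q = begin
    countBelow P (suc n)               ≡⟨ countBelow-suc P n ⟩
    countBelow P n + indicator (P n)   ≡⟨ cong₂ _+_ (countBelow-cong n (λ k k<n → P≡Q k (m<n⇒m<1+n k<n)))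
                                                    (cong indicator (P≡Q n (n<1+n n))) ⟩
    countBelow Q n + indicator (Q n)   ≡⟨ countBelow-suc Q n ⟨
    countBelow Q (suc n)               ∎
    where open ≡-Reasoning

  countBelow-mono : ∀ P {m n} → m ≤ n → countBelow P m ≤ countBelow P n
  countBelow-mono P {n = zero}  z≤n = z≤n
  countBelow-mono P {m} {suc n} m≤1+n with m≤n⇒m<n∨m≡n m≤1+n
  ... | inj₂ refl = ≤-refl
  ... | inj₁ m<1+n = begin
    countBelow P m                    ≤⟨ countBelow-mono P (≤-pred m<1+n) ⟩
    countBelow P n                    ≤⟨ m≤m+n _ _ ⟩
    countBelow P n + indicator (P n)  ≡⟨ countBelow-suc P n ⟨
    countBelow P (suc n)              ∎
    where open ≤-Reasoning

  countBelow-stable : ∀ P {m n} → m ≤ n → (∀ k → m ≤ k → k < n → P k ≡ false) →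
    countBelow P n ≡ countBelow P m
  countBelow-stable P {n = zero}  z≤n _ = refl
  countBelow-stable P {m} {suc n} m≤1+n P≡false with m≤n⇒m<n∨m≡n m≤1+n
  ... | inj₂ refl = refl
  ... | inj₁ m<1+n = begin
    countBelow P (suc n)              ≡⟨ countBelow-suc P n ⟩
    countBelow P n + indicator (P n)  ≡⟨ cong (λ b → countBelow P n + indicator b) (P≡false n (≤-pred m<1+n) (n<1+n n)) ⟩
    countBelow P n + 0                ≡⟨ +-identityʳ _ ⟩
    countBelow P n                    ≡⟨ countBelow-stable P (≤-pred m<1+n) (λ k m≤k k<n →
                                           P≡false k m≤k (m<n⇒m<1+n k<n)) ⟩
    countBelow P m                    ∎
    where open ≡-Reasoning

  indicator-split : ∀ a b → indicator a ≡ indicator (a ∧ not b) + indicator (a ∧ b)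
  indicator-split true  true  = refl
  indicator-split true  false = refl
  indicator-split false _     = refl

  countBelow-split : ∀ (P d : ℕ → Bool) n →
    countBelow P n ≡ countBelow (λ k → P k ∧ not (d k)) n + countBelow (λ k → P k ∧ d k) n
  countBelow-split P d zero    = refl
  countBelow-split P d (suc n) = begin
    countBelow P (suc n)                                   ≡⟨ countBelow-suc P n ⟩
    countBelow P n + indicator (P n)                       ≡⟨ cong₂ _+_ (countBelow-split P d n) (indicator-split (P n) (d n)) ⟩
    (countBelow P₀ n + countBelow P₁ n) + (indicator (P₀ n) + indicator (P₁ n))
                                                           ≡⟨ interchange (countBelow P₀ n) (countBelow P₁ n) _ _ ⟩
    (countBelow P₀ n + indicator (P₀ n)) + (countBelow P₁ n + indicator (P₁ n))
                                                           ≡⟨ cong₂ _+_ (countBelow-suc P₀ n) (countBelow-suc P₁ n) ⟨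
    countBelow P₀ (suc n) + countBelow P₁ (suc n)          ∎
    where
    open ≡-Reasoning
    P₀ P₁ : ℕ → Bool
    P₀ k = P k ∧ not (d k)
    P₁ k = P k ∧ d k

  length-filterᵇ-map : ∀ {A B : Set} (P : B → Bool) (g : A → B) xs →
    length (filterᵇ P (map g xs)) ≡ length (filterᵇ (P ∘ g) xs)
  length-filterᵇ-map P g [] = refl
  length-filterᵇ-map P g (x ∷ xs) with P (g x)
  ... | true  = cong suc (length-filterᵇ-map P g xs)
  ... | false = length-filterᵇ-map P g xs

  countUpTo-countBelow : ∀ f x → countUpTo f x ≡ countBelow (f ∘ suc) x
  countUpTo-countBelow f x = length-filterᵇ-map f suc (upTo x)

  countUpTo-suc : ∀ f x → countUpTo f (suc x) ≡ countUpTo f x + indicator (f (suc x))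
  countUpTo-suc f x = begin
    countUpTo f (suc x)                          ≡⟨ countUpTo-countBelow f (suc x) ⟩
    countBelow (f ∘ suc) (suc x)                 ≡⟨ countBelow-suc (f ∘ suc) x ⟩
    countBelow (f ∘ suc) x + indicator (f (suc x)) ≡⟨ cong (_+ indicator (f (suc x))) (countUpTo-countBelow f x) ⟨
    countUpTo f x + indicator (f (suc x))        ∎
    where open ≡-Reasoning

  countUpTo-cong : ∀ {f g} → (∀ n → f (suc n) ≡ g (suc n)) → ∀ x → countUpTo f x ≡ countUpTo g x
  countUpTo-cong {f} {g} f≡g x = begin
    countUpTo f x           ≡⟨ countUpTo-countBelow f x ⟩
    countBelow (f ∘ suc) x  ≡⟨ countBelow-cong x (λ n _ → f≡g n) ⟩
    countBelow (g ∘ suc) x  ≡⟨ countUpTo-countBelow g x ⟨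
    countUpTo g x           ∎
    where open ≡-Reasoning

  countUpTo-stable : ∀ f {x y} → x ≤ y → (∀ n → x < n → n ≤ y → f n ≡ false) →
    countUpTo f y ≡ countUpTo f x
  countUpTo-stable f {x} {y} x≤y f≡false = begin
    countUpTo f y           ≡⟨ countUpTo-countBelow f y ⟩
    countBelow (f ∘ suc) y  ≡⟨ countBelow-stable (f ∘ suc) x≤y (λ n x≤n n<y → f≡false (suc n) (s≤s x≤n) n<y) ⟩
    countBelow (f ∘ suc) x  ≡⟨ countUpTo-countBelow f x ⟨
    countUpTo f x           ∎
    where open ≡-Reasoning

  countUpTo-split : ∀ f (d : ℕ → Bool) x →
    countUpTo f x ≡ countUpTo (λ n → f n ∧ not (d n)) x + countUpTo (λ n → f n ∧ d n) x
  countUpTo-split f d x = begin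
    countUpTo f x            ≡⟨ countUpTo-countBelow f x ⟩
    countBelow (f ∘ suc) x   ≡⟨ countBelow-split (f ∘ suc) (d ∘ suc) x ⟩
    countBelow (λ n → f (suc n) ∧ not (d (suc n))) x + countBelow (λ n → f (suc n) ∧ d (suc n)) x
                             ≡⟨ cong₂ _+_ (countUpTo-countBelow _ x) (countUpTo-countBelow _ x) ⟨
    countUpTo (λ n → f n ∧ not (d n)) x + countUpTo (λ n → f n ∧ d n) x ∎
    where open ≡-Reasoning

  ∤-between-multiples : ∀ {k m n} → k * m < n → n < k * suc m → ¬ k ∣ n
  ∤-between-multiples {k} {m} {n} km<n n<k[1+m] (divides q refl) =
    <⇒≱ (*-cancelʳ-< k m q (subst (_< q * k) (*-comm k m) km<n))
        (≤-pred (*-cancelʳ-< k q (suc m) (subst (q * k <_) (*-comm k (suc m)) n<k[1+m])))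

  countUpTo-multiples : ∀ k .{{_ : NonZero k}} f → (∀ n → ¬ k ∣ n → f n ≡ false) →
    ∀ m → countUpTo f (k * m) ≡ countUpTo (f ∘ (k *_)) m
  countUpTo-multiples (suc k) f f≡false zero    = cong (countUpTo f) (*-zeroʳ k)
  countUpTo-multiples (suc k) f f≡false (suc m) = begin
    countUpTo f (K * suc m)                    ≡⟨ cong (countUpTo f) K[1+m]≡1+Km+k ⟩
    countUpTo f (suc (K * m + k))              ≡⟨ countUpTo-suc f (K * m + k) ⟩
    countUpTo f (K * m + k) + indicator (f (suc (K * m + k)))
                                               ≡⟨ cong₂ (λ c n → c + indicator (f n)) within-block (sym K[1+m]≡1+Km+k) ⟩
    countUpTo f (K * m) + indicator (f (K * suc m))
                                               ≡⟨ cong (_+ indicator (f (K * suc m))) (countUpTo-multiples K f f≡false m) ⟩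
    countUpTo (f ∘ (K *_)) m + indicator (f (K * suc m))
                                               ≡⟨ countUpTo-suc (f ∘ (K *_)) m ⟨
    countUpTo (f ∘ (K *_)) (suc m)             ∎
    where
    open ≡-Reasoning
    K : ℕ
    K = suc k
    K[1+m]≡1+Km+k : K * suc m ≡ suc (K * m + k)
    K[1+m]≡1+Km+k = trans (*-suc K m) (cong suc (+-comm k (K * m)))
    within-block : countUpTo f (K * m + k) ≡ countUpTo f (K * m)
    within-block = countUpTo-stable f (m≤m+n (K * m) k) λ n Km<n n≤Km+k →
      f≡false n (∤-between-multiples Km<n (subst (n <_) (sym K[1+m]≡1+Km+k) (s≤s n≤Km+k)))

  primeCount-suc-prime : ∀ {k} → Prime k → primeCount (suc k) ≡ suc (primeCount k)
  primeCount-suc-prime {k} k-prime = begin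
    primeCount (suc k)                             ≡⟨ countBelow-suc _ k ⟩
    primeCount k + indicator (does (prime? k))     ≡⟨ cong (λ b → primeCount k + indicator b) (dec-true (prime? k) k-prime) ⟩
    primeCount k + 1                               ≡⟨ +-comm (primeCount k) 1 ⟩
    suc (primeCount k)                             ∎
    where open ≡-Reasoning

  primeCount-mono : ∀ {m n} → m ≤ n → primeCount m ≤ primeCount n
  primeCount-mono = countBelow-mono _

  primeCount-<-⇔ : ∀ {k n} → Prime k → primeCount k < primeCount n ⇔ k < n
  primeCount-<-⇔ {k} {n} k-prime = mk⇔
    (λ πk<πn → ≰⇒> (λ n≤k → <⇒≱ πk<πn (primeCount-mono n≤k)))
    (λ k<n → subst (_≤ primeCount n) (primeCount-suc-prime k-prime) (primeCount-mono k<n))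

  ∣P*m⇔∣m : ∀ {k P m} → Prime P → .{{_ : NonZero k}} → k < P → k ∣ P * m ⇔ k ∣ m
  ∣P*m⇔∣m {P = P} P-prime k<P = mk⇔ (coprime-divisor (coprime-sym (prime⇒coprime P-prime k<P))) (∣n⇒∣m*n P)

  primeDivCountBelow-* : ∀ {P} → Prime P → ∀ m → primeDivCountBelow P (P * m) ≡ primeDivCountBelow P m
  primeDivCountBelow-* {P} P-prime m = countBelow-cong P same-divisors
    where
    same-divisors : ∀ k → k < P → does (prime? k) ∧ does (k ∣? P * m) ≡ does (prime? k) ∧ does (k ∣? m)
    same-divisors k k<P with prime? k
    ... | no  _       = refl
    ... | yes k-prime = does-⇔ (∣P*m⇔∣m P-prime {{prime⇒nonZero k-prime}} k<P) (k ∣? P * m) (k ∣? m)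

  exactlyBelow : ℕ → ℕ → ℕ → Bool
  exactlyBelow j P n = primeDivCountBelow P n ≡ᵇ j

  kthPrimeDiv-∤ : ∀ k {P n} → ¬ P ∣ n → kthPrimeDiv k P n ≡ false
  kthPrimeDiv-∤ k {P} {n} P∤n rewrite dec-false (P ∣? n) P∤n = ∧-zeroʳ (does (prime? P))

  kthPrimeDiv-* : ∀ {P} → Prime P → ∀ r m → kthPrimeDiv (suc r) P (P * m) ≡ exactlyBelow r P m
  kthPrimeDiv-* {P} P-prime r m
    rewrite dec-true (prime? P) P-prime | dec-true (P ∣? P * m) (m∣m*n m) | primeDivCountBelow-* P-prime m = refl

  countUpTo-kthPrimeDiv : ∀ {P} → Prime P → ∀ r m →
    countUpTo (kthPrimeDiv (suc r) P) (P * m) ≡ countUpTo (exactlyBelow r P) m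
  countUpTo-kthPrimeDiv {P} P-prime r m = begin
    countUpTo (kthPrimeDiv (suc r) P) (P * m)
      ≡⟨ countUpTo-multiples P {{prime⇒nonZero P-prime}} _ (λ _ → kthPrimeDiv-∤ (suc r)) m ⟩
    countUpTo (kthPrimeDiv (suc r) P ∘ (P *_)) m        ≡⟨ countUpTo-cong (kthPrimeDiv-* P-prime r ∘ suc) m ⟩
    countUpTo (exactlyBelow r P) m                      ∎
    where open ≡-Reasoning

  countUpTo-split-multiples : ∀ k .{{_ : NonZero k}} f m →
    countUpTo f (k * m) ≡ countUpTo (λ n → f n ∧ not (does (k ∣? n))) (k * m) + countUpTo (f ∘ (k *_)) m
  countUpTo-split-multiples k f m = begin
    countUpTo f (k * m)                                                 ≡⟨ countUpTo-split f (does ∘ (k ∣?_)) (k * m) ⟩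
    countUpTo f∤ (k * m) + countUpTo (λ n → f n ∧ does (k ∣? n)) (k * m) ≡⟨ cong (countUpTo f∤ (k * m) +_) multiples ⟩
    countUpTo f∤ (k * m) + countUpTo (f ∘ (k *_)) m                      ∎
    where
    open ≡-Reasoning
    f∤ : ℕ → Bool
    f∤ n = f n ∧ not (does (k ∣? n))
    vanishes : ∀ n → ¬ k ∣ n → f n ∧ does (k ∣? n) ≡ false
    vanishes n k∤n rewrite dec-false (k ∣? n) k∤n = ∧-zeroʳ (f n)
    on-multiples : ∀ n → f (k * n) ∧ does (k ∣? k * n) ≡ f (k * n)
    on-multiples n rewrite dec-true (k ∣? k * n) (m∣m*n n) = ∧-identityʳ (f (k * n))
    multiples : countUpTo (λ n → f n ∧ does (k ∣? n)) (k * m) ≡ countUpTo (f ∘ (k *_)) m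
    multiples = trans (countUpTo-multiples k _ vanishes m) (countUpTo-cong (on-multiples ∘ suc) m)

  exactlyUpTo : ℕ → ℕ → ℕ → Bool
  exactlyUpTo j P n = indicator (does (P ∣? n)) + primeDivCountBelow P n ≡ᵇ j

  -- Split n ≤ P m by whether P ∣ n: off the multiples of P the two predicates agree,
  -- and at n = P k the prime P itself raises the count of k by one.
  countUpTo-exactlyUpTo : ∀ {P} → Prime P → ∀ j m →
    countUpTo (exactlyUpTo (suc j) P) (P * m) + countUpTo (exactlyBelow (suc j) P) m
    ≡ countUpTo (exactlyBelow (suc j) P) (P * m) + countUpTo (exactlyBelow j P) m
  countUpTo-exactlyUpTo {P} P-prime j m = begin
    countUpTo upToP (P * m) + S (suc j)
      ≡⟨ cong (_+ S (suc j)) (countUpTo-split-multiples P upToP m) ⟩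
    countUpTo (λ n → upToP n ∧ not (P∣ n)) (P * m) + countUpTo (upToP ∘ (P *_)) m + S (suc j)
      ≡⟨ cong₂ (λ x y → x + y + S (suc j)) (countUpTo-cong (agree-off-multiples ∘ suc) (P * m))
                                           (countUpTo-cong (upToP-on-multiples ∘ suc) m) ⟩
    N + S j + S (suc j)
      ≡⟨ xy∙z≈xz∙y N (S j) (S (suc j)) ⟩
    N + S (suc j) + S j
      ≡⟨ cong (_+ S j) (trans (countUpTo-split-multiples P belowP m)
                              (cong (N +_) (countUpTo-cong (belowP-on-multiples ∘ suc) m))) ⟨
    countUpTo belowP (P * m) + S j ∎
    where
    open ≡-Reasoning
    instance _ = prime⇒nonZero P-prime
    P∣ upToP belowP : ℕ → Bool
    P∣ n = does (P ∣? n)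
    upToP = exactlyUpTo (suc j) P
    belowP = exactlyBelow (suc j) P
    S : ℕ → ℕ
    S ℓ = countUpTo (exactlyBelow ℓ P) m
    N : ℕ
    N = countUpTo (λ n → belowP n ∧ not (P∣ n)) (P * m)
    agree-off-multiples : ∀ n → upToP n ∧ not (P∣ n) ≡ belowP n ∧ not (P∣ n)
    agree-off-multiples n with P∣ n
    ... | true  = trans (∧-zeroʳ _) (sym (∧-zeroʳ _))
    ... | false = refl
    upToP-on-multiples : ∀ n → upToP (P * n) ≡ exactlyBelow j P n
    upToP-on-multiples n rewrite dec-true (P ∣? P * n) (m∣m*n n) | primeDivCountBelow-* P-prime n = refl
    belowP-on-multiples : ∀ n → belowP (P * n) ≡ belowP n
    belowP-on-multiples n = cong (_≡ᵇ suc j) (primeDivCountBelow-* P-prime n)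

  module ConsecutivePrimes {i p q} (p-prime : Prime p) (π[p]≡i : primeCount p ≡ i)
                                   (q-prime : Prime q) (π[q]≡1+i : primeCount q ≡ suc i) where

    p<q : p < q
    p<q = Equivalence.to (primeCount-<-⇔ p-prime) (subst₂ _<_ (sym π[p]≡i) (sym π[q]≡1+i) (n<1+n i))

    no-prime-between : ∀ {k} → Prime k → p < k → k < q → ⊥
    no-prime-between {k} k-prime p<k k<q = <⇒≱ (subst (_< primeCount k) π[p]≡i (Equivalence.from (primeCount-<-⇔ p-prime) p<k))
      (≤-pred (subst (primeCount k <_) π[q]≡1+i (Equivalence.from (primeCount-<-⇔ k-prime) k<q)))

    primeDivCountBelow-next : ∀ n → primeDivCountBelow q n ≡ indicator (does (p ∣? n)) + primeDivCountBelow p n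
    primeDivCountBelow-next n = begin
      countBelow primeDivisor q                ≡⟨ countBelow-stable primeDivisor p<q (λ k p<k k<q → not-between k p<k k<q) ⟩
      countBelow primeDivisor (suc p)          ≡⟨ countBelow-suc primeDivisor p ⟩
      primeDivCountBelow p n + indicator (primeDivisor p)
                                               ≡⟨ cong (λ b → primeDivCountBelow p n + indicator (b ∧ does (p ∣? n))) (dec-true (prime? p) p-prime) ⟩
      primeDivCountBelow p n + indicator (does (p ∣? n))
                                               ≡⟨ +-comm (primeDivCountBelow p n) _ ⟩
      indicator (does (p ∣? n)) + primeDivCountBelow p n ∎
      where
      open ≡-Reasoning
      primeDivisor : ℕ → Bool
      primeDivisor k = does (prime? k) ∧ does (k ∣? n)
      not-between : ∀ k → p < k → k < q → primeDivisor k ≡ false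
      not-between k p<k k<q with prime? k
      ... | yes k-prime = ⊥-elim (no-prime-between k-prime p<k k<q)
      ... | no  _       = refl

    primeCount<ᵇi≡<ᵇp : ∀ {k} → Prime k → (primeCount k <ᵇ i) ≡ (k <ᵇ p)
    primeCount<ᵇi≡<ᵇp {k} k-prime = subst (λ t → (primeCount k <ᵇ t) ≡ (k <ᵇ p)) π[p]≡i
      (does-⇔ (primeCount-<-⇔ k-prime) (primeCount k <? primeCount p) (k <? p))

    exactlyAmongFirst≡exactlyBelow : ∀ j n → exactlyAmongFirst j i (suc n) ≡ exactlyBelow j p (suc n)
    exactlyAmongFirst≡exactlyBelow j n = cong (_≡ᵇ j) (begin
      countBelow amongFirst (suc N)   ≡⟨ countBelow-cong (suc N) (λ k _ → amongFirst≡belowP k) ⟩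
      countBelow belowP (suc N)       ≡⟨ countBelow-stable belowP (m≤n+m (suc N) p) (λ k N<k _ → belowP-above-N k N<k) ⟨
      countBelow belowP (p + suc N)   ≡⟨ countBelow-stable belowP (m≤m+n p (suc N)) (λ k p≤k _ → belowP-from-p k p≤k) ⟩
      countBelow belowP p             ≡⟨ countBelow-cong p belowP-below-p ⟩
      primeDivCountBelow p N          ∎)
      where
      open ≡-Reasoning
      N : ℕ
      N = suc n
      amongFirst belowP : ℕ → Bool
      amongFirst k = does (prime? k) ∧ (primeCount k <ᵇ i) ∧ does (k ∣? N)
      belowP k     = does (prime? k) ∧ (k <ᵇ p) ∧ does (k ∣? N)
      amongFirst≡belowP : ∀ k → amongFirst k ≡ belowP k
      amongFirst≡belowP k with prime? k
      ... | yes k-prime = cong (_∧ does (k ∣? N)) (primeCount<ᵇi≡<ᵇp k-prime)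
      ... | no  _       = refl
      belowP-above-N : ∀ k → N < k → belowP k ≡ false
      belowP-above-N k N<k
        rewrite dec-false (k ∣? N) (λ k∣N → <⇒≱ N<k (∣⇒≤ k∣N)) | ∧-zeroʳ (k <ᵇ p) = ∧-zeroʳ _
      belowP-from-p : ∀ k → p ≤ k → belowP k ≡ false
      belowP-from-p k p≤k rewrite dec-false (k <? p) (≤⇒≯ p≤k) = ∧-zeroʳ _
      belowP-below-p : ∀ k → k < p → belowP k ≡ does (prime? k) ∧ does (k ∣? N)
      belowP-below-p k k<p rewrite dec-true (k <? p) k<p = refl

    countUpTo-exactlyAmongFirst : ∀ j x → countUpTo (exactlyAmongFirst j i) x ≡ countUpTo (exactlyBelow j p) x
    countUpTo-exactlyAmongFirst j = countUpTo-cong (exactlyAmongFirst≡exactlyBelow j)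

    countUpTo-kthPrimeDiv-p : ∀ r m → countUpTo (kthPrimeDiv (suc r) p) (p * m) ≡ countUpTo (exactlyAmongFirst r i) m
    countUpTo-kthPrimeDiv-p r m = trans (countUpTo-kthPrimeDiv p-prime r m) (sym (countUpTo-exactlyAmongFirst r m))

    exactlyBelow-q≡exactlyUpTo-p : ∀ j n → exactlyBelow j q n ≡ exactlyUpTo j p n
    exactlyBelow-q≡exactlyUpTo-p j n = cong (_≡ᵇ j) (primeDivCountBelow-next n)

    countUpTo-kthPrimeDiv-q : ∀ r m →
      countUpTo (kthPrimeDiv (suc (suc r)) q) (q * (p * m)) + countUpTo (exactlyAmongFirst (suc r) i) m
      ≡ countUpTo (exactlyAmongFirst (suc r) i) (p * m) + countUpTo (exactlyAmongFirst r i) m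
    countUpTo-kthPrimeDiv-q r m = begin
      countUpTo (kthPrimeDiv (suc (suc r)) q) (q * (p * m)) + countUpTo (exactlyAmongFirst (suc r) i) m
        ≡⟨ cong₂ _+_ (trans (countUpTo-kthPrimeDiv q-prime (suc r) (p * m))
                            (countUpTo-cong (exactlyBelow-q≡exactlyUpTo-p (suc r) ∘ suc) (p * m)))
                     (countUpTo-exactlyAmongFirst (suc r) m) ⟩
      countUpTo (exactlyUpTo (suc r) p) (p * m) + countUpTo (exactlyBelow (suc r) p) m
        ≡⟨ countUpTo-exactlyUpTo p-prime r m ⟩
      countUpTo (exactlyBelow (suc r) p) (p * m) + countUpTo (exactlyBelow r p) m
        ≡⟨ cong₂ _+_ (countUpTo-exactlyAmongFirst (suc r) (p * m)) (countUpTo-exactlyAmongFirst r m) ⟨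
      countUpTo (exactlyAmongFirst (suc r) i) (p * m) + countUpTo (exactlyAmongFirst r i) m ∎
      where open ≡-Reasoning

module Densities where

  open import Data.Nat as ℕ using (ℕ; suc)
  import Data.Nat.Properties as ℕₚ
  open import Data.Integer as ℤ using (+_)
  import Data.Integer.Properties as ℤₚ
  open import Data.Integer.Tactic.RingSolver using (solve-∀)
  open import Data.Product using (_×_; _,_; proj₂; ∃-syntax)
  open import Data.Rational
  open import Data.Rational.Properties
  open import Data.Rational.Unnormalised using (ℚᵘ; mkℚᵘ; *≡*) renaming (_+_ to _+ᵘ_; _*_ to _*ᵘ_)
  import Data.Rational.Unnormalised.Properties as ℚᵘₚ
  open import Data.Rational.Solver using (module +-*-Solver)
  open import Algebra.Properties.Group +-0-group using (x∙y⁻¹≈ε⇒x≈y)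
  open import Function using (_∘_)
  open import Function.Bundles using (_⇔_; mk⇔; Equivalence)
  open import Relation.Nullary using (yes; no; contradiction)
  open import Relation.Binary.PropositionalEquality
    using (_≡_; refl; sym; trans; cong; cong₂; subst; subst₂; _≗_; module ≡-Reasoning)

  open +-*-Solver

  Eventually : (ℕ → Set) → Set
  Eventually P = ∃[ N ] (∀ y → N ℕ.≤ y → P y)

  eventually-map : ∀ {P Q : ℕ → Set} → (∀ y → P y → Q y) → Eventually P → Eventually Q
  eventually-map P⇒Q (N , P-from-N) = N , λ y N≤y → P⇒Q y (P-from-N y N≤y)

  eventually-× : ∀ {P Q : ℕ → Set} → Eventually P → Eventually Q → Eventually (λ y → P y × Q y)
  eventually-× (M , P-from-M) (N , Q-from-N) =
    M ℕ.⊔ N , λ y M⊔N≤y → P-from-M y (ℕₚ.m⊔n≤o⇒m≤o M N M⊔N≤y) , Q-from-N y (ℕₚ.m⊔n≤o⇒n≤o M N M⊔N≤y)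

  infix 4 _⟶_
  record _⟶_ (s : ℕ → ℚ) (ℓ : ℚ) : Set where
    constructor converges
    field eventually-close : ∀ ε → 0ℚ < ε → Eventually (λ y → ∣ s y - ℓ ∣ < ε)

  ∣+∣< : ∀ {a b ε δ} → ∣ a ∣ < ε → ∣ b ∣ < δ → ∣ a + b ∣ < ε + δ
  ∣+∣< {a} {b} ∣a∣<ε ∣b∣<δ = ≤-<-trans (∣p+q∣≤∣p∣+∣q∣ a b) (+-mono-< ∣a∣<ε ∣b∣<δ)

  ∣x-y∣≡∣y-x∣ : ∀ x y → ∣ x - y ∣ ≡ ∣ y - x ∣
  ∣x-y∣≡∣y-x∣ x y = trans (cong ∣_∣ (solve 2 (λ x y → x :- y := :- (y :- x)) refl x y)) (∣-p∣≡∣p∣ (y - x))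

  x+x≡x*2 : ∀ x → x + x ≡ x * (+ 2 / 1)
  x+x≡x*2 = solve 1 (λ x → x :+ x := x :* con (+ 2 / 1)) refl

  ⟶-by-multiple : ∀ {s ℓ} K .{{_ : Positive K}} →
    (∀ ε → 0ℚ < ε → Eventually (λ y → ∣ s y - ℓ ∣ < ε * K)) → s ⟶ ℓ
  ⟶-by-multiple {s} {ℓ} K close = converges λ ε 0<ε →
    eventually-map (λ y → subst (∣ s y - ℓ ∣ <_) (ε/K*K≡ε ε)) (close (ε * 1/ K) (0<ε/K 0<ε))
    where
    instance
      _ = pos⇒nonZero K
    0<ε/K : ∀ {ε} → 0ℚ < ε → 0ℚ < ε * 1/ K
    0<ε/K {ε} 0<ε = positive⁻¹ _ {{pos*pos⇒pos ε {{positive 0<ε}} (1/ K) {{1/pos⇒pos K}}}}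
    ε/K*K≡ε : ∀ ε → ε * 1/ K * K ≡ ε
    ε/K*K≡ε ε = trans (*-assoc ε (1/ K) K) (trans (cong (ε *_) (*-inverseˡ K)) (*-identityʳ ε))

  const-⟶⇒≡ : ∀ {x ℓ} → (λ _ → x) ⟶ ℓ → x ≡ ℓ
  const-⟶⇒≡ {x} {ℓ} (converges close) with x ≟ ℓ
  ... | yes x≡ℓ = x≡ℓ
  ... | no  x≢ℓ = contradiction (proj₂ (close ∣ x - ℓ ∣ 0<∣x-ℓ∣) _ ℕₚ.≤-refl) (<-irrefl refl)
    where
    0<∣x-ℓ∣ : 0ℚ < ∣ x - ℓ ∣
    0<∣x-ℓ∣ = ≰⇒> λ ∣x-ℓ∣≤0 →
      x≢ℓ (x∙y⁻¹≈ε⇒x≈y x ℓ (∣p∣≡0⇒p≡0 (x - ℓ) (≤-antisym ∣x-ℓ∣≤0 (0≤∣p∣ (x - ℓ)))))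

  ⟶-unique : ∀ {s ℓ m} → s ⟶ ℓ → s ⟶ m → ℓ ≡ m
  ⟶-unique {s} {ℓ} {m} (converges s⟶ℓ) (converges s⟶m) = const-⟶⇒≡ (⟶-by-multiple (+ 2 / 1) λ ε 0<ε →
    eventually-map (λ y (close-ℓ , close-m) → subst₂ (λ a b → ∣ a ∣ < b) (ℓ-y+y-m y) (x+x≡x*2 ε)
                     (∣+∣< (subst (_< ε) (∣x-y∣≡∣y-x∣ (s y) ℓ) close-ℓ) close-m))
                   (eventually-× (s⟶ℓ ε 0<ε) (s⟶m ε 0<ε)))
    where
    ℓ-y+y-m : ∀ y → ℓ - s y + (s y - m) ≡ ℓ - m
    ℓ-y+y-m y = solve 3 (λ ℓ sy m → ℓ :- sy :+ (sy :- m) := ℓ :- m) refl ℓ (s y) m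

  ⟶-cong : ∀ {s t ℓ} → s ≗ t → s ⟶ ℓ → t ⟶ ℓ
  ⟶-cong {ℓ = ℓ} s≗t (converges s⟶ℓ) = converges λ ε 0<ε →
    eventually-map (λ y → subst (λ a → ∣ a - ℓ ∣ < ε) (s≗t y)) (s⟶ℓ ε 0<ε)

  ⟶-subsequence : ∀ {s ℓ} (φ : ℕ → ℕ) → (∀ y → y ℕ.≤ φ y) → s ⟶ ℓ → (s ∘ φ) ⟶ ℓ
  ⟶-subsequence φ y≤φy (converges s⟶ℓ) = converges λ ε 0<ε →
    let (N , close) = s⟶ℓ ε 0<ε in N , λ y N≤y → close (φ y) (ℕₚ.≤-trans N≤y (y≤φy y))

  ⟶-*ʳ : ∀ {s ℓ} k .{{_ : Positive k}} → s ⟶ ℓ → (λ y → s y * k) ⟶ ℓ * k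
  ⟶-*ʳ {s} {ℓ} k (converges s⟶ℓ) = ⟶-by-multiple k λ ε 0<ε → eventually-map scale (s⟶ℓ ε 0<ε)
    where
    scale : ∀ {ε} y → ∣ s y - ℓ ∣ < ε → ∣ s y * k - ℓ * k ∣ < ε * k
    scale {ε} y close = subst (_< ε * k) (begin
        ∣ s y - ℓ ∣ * k        ≡⟨ cong (∣ s y - ℓ ∣ *_) (0≤p⇒∣p∣≡p (<⇒≤ (positive⁻¹ k))) ⟨
        ∣ s y - ℓ ∣ * ∣ k ∣    ≡⟨ ∣p*q∣≡∣p∣*∣q∣ (s y - ℓ) k ⟨
        ∣ (s y - ℓ) * k ∣      ≡⟨ cong ∣_∣ (solve 3 (λ a b k → (a :- b) :* k := a :* k :- b :* k) refl (s y) ℓ k) ⟩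
        ∣ s y * k - ℓ * k ∣    ∎)
      (*-monoˡ-<-pos k close)
      where open ≡-Reasoning

  ⟶-+ : ∀ {s t ℓ m} → s ⟶ ℓ → t ⟶ m → (λ y → s y + t y) ⟶ ℓ + m
  ⟶-+ {s} {t} {ℓ} {m} (converges s⟶ℓ) (converges t⟶m) = ⟶-by-multiple (+ 2 / 1) λ ε 0<ε →
    eventually-map (λ y (close-s , close-t) →
                     subst₂ (λ a b → ∣ a ∣ < b) (rearrange y) (x+x≡x*2 ε) (∣+∣< close-s close-t))
                   (eventually-× (s⟶ℓ ε 0<ε) (t⟶m ε 0<ε))
    where
    rearrange : ∀ y → s y - ℓ + (t y - m) ≡ s y + t y - (ℓ + m)
    rearrange y = solve 4 (λ a b c d → a :- b :+ (c :- d) := a :+ c :- (b :+ d)) refl (s y) ℓ (t y) m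

  fromℚᵘ-homo-+ : ∀ p q → fromℚᵘ (p +ᵘ q) ≡ fromℚᵘ p + fromℚᵘ q
  fromℚᵘ-homo-+ p q = toℚᵘ-injective (ℚᵘₚ.≃-trans (toℚᵘ-fromℚᵘ (p +ᵘ q))
    (ℚᵘₚ.≃-sym (ℚᵘₚ.≃-trans (toℚᵘ-homo-+ (fromℚᵘ p) (fromℚᵘ q))
                            (ℚᵘₚ.+-cong (toℚᵘ-fromℚᵘ p) (toℚᵘ-fromℚᵘ q)))))

  fromℚᵘ-homo-* : ∀ p q → fromℚᵘ (p *ᵘ q) ≡ fromℚᵘ p * fromℚᵘ q
  fromℚᵘ-homo-* p q = toℚᵘ-injective (ℚᵘₚ.≃-trans (toℚᵘ-fromℚᵘ (p *ᵘ q))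
    (ℚᵘₚ.≃-sym (ℚᵘₚ.≃-trans (toℚᵘ-homo-* (fromℚᵘ p) (fromℚᵘ q))
                            (ℚᵘₚ.*-cong (toℚᵘ-fromℚᵘ p) (toℚᵘ-fromℚᵘ q)))))

  fromℕ : ℕ → ℚ
  fromℕ n = + n / 1

  fromℕ-pos : ∀ n .{{_ : ℕ.NonZero n}} → Positive (fromℕ n)
  fromℕ-pos (suc n) = normalize-pos (suc n) 1

  /-+ : ∀ x y n → + (x ℕ.+ y) / suc n ≡ + x / suc n + + y / suc n
  /-+ x y n = trans (fromℚᵘ-cong {mkℚᵘ (+ (x ℕ.+ y)) n} {mkℚᵘ (+ x) n +ᵘ mkℚᵘ (+ y) n} (*≡* cross))
                    (fromℚᵘ-homo-+ (mkℚᵘ (+ x) n) (mkℚᵘ (+ y) n))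
    where
    N : ℕ
    N = suc n
    cross : + (x ℕ.+ y) ℤ.* + (N ℕ.* N) ≡ (+ x ℤ.* + N ℤ.+ + y ℤ.* + N) ℤ.* + N
    cross rewrite ℤₚ.pos-+ x y | ℤₚ.pos-* N N = ring (+ x) (+ y) (+ N)
      where
      ring : ∀ a b c → (a ℤ.+ b) ℤ.* (c ℤ.* c) ≡ (a ℤ.* c ℤ.+ b ℤ.* c) ℤ.* c
      ring = solve-∀

  fromℕ-+ : ∀ m n → fromℕ (m ℕ.+ n) ≡ fromℕ m + fromℕ n
  fromℕ-+ m n = /-+ m n 0

  /[k*n]*k≡/n : ∀ x k n → + x / (suc k ℕ.* suc n) * fromℕ (suc k) ≡ + x / suc n
  /[k*n]*k≡/n x k n =
    trans (sym (fromℚᵘ-homo-* x/KN (mkℚᵘ (+ K) 0))) (fromℚᵘ-cong {x/KN *ᵘ mkℚᵘ (+ K) 0} {mkℚᵘ (+ x) n} (*≡* cross))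
    where
    K N : ℕ
    K = suc k
    N = suc n
    x/KN : ℚᵘ
    x/KN = mkℚᵘ (+ x) (n ℕ.+ k ℕ.* N)
    cross : (+ x ℤ.* + K) ℤ.* + N ≡ + x ℤ.* + (K ℕ.* N ℕ.* 1)
    cross rewrite ℤₚ.pos-* (K ℕ.* N) 1 | ℤₚ.pos-* K N = ring (+ x) (+ K) (+ N)
      where
      ring : ∀ a b c → (a ℤ.* b) ℤ.* c ≡ a ℤ.* ((b ℤ.* c) ℤ.* + 1)
      ring = solve-∀

  -- Opaque, so that unifying ratio F ⟶ d with ratio G ⟶ d′ solves F = G instead of
  -- unfolding both sides into normalised fractions.
  opaque
    ratio : (ℕ → ℕ) → ℕ → ℚ
    ratio F y = + F (suc y) / suc y

    HasDensity⇒ratio⟶ : ∀ {f d} → HasDensity f d → ratio (countUpTo f) ⟶ d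
    HasDensity⇒ratio⟶ = converges

    ratio-cong : ∀ {F G d} → (∀ n → F n ≡ G n) → ratio F ⟶ d → ratio G ⟶ d
    ratio-cong F≡G = ⟶-cong (λ y → cong (λ x → + x / suc y) (F≡G (suc y)))

    ratio-+ : ∀ {F G d e} → ratio F ⟶ d → ratio G ⟶ e → ratio (λ n → F n ℕ.+ G n) ⟶ d + e
    ratio-+ {F} {G} F⟶d G⟶e = ⟶-cong (λ y → sym (/-+ (F (suc y)) (G (suc y)) y)) (⟶-+ F⟶d G⟶e)

    ratio-∘-* : ∀ {F d} k .{{_ : ℕ.NonZero k}} → ratio F ⟶ d → ratio (F ∘ (k ℕ.*_)) ⟶ d * fromℕ k
    ratio-∘-* {F} {d} (suc k) F⟶d =
      ⟶-cong (λ y → /[k*n]*k≡/n (F (suc k ℕ.* suc y)) k y)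
        (⟶-*ʳ (fromℕ (suc k)) {{fromℕ-pos (suc k)}} (⟶-subsequence φ (λ y → ℕₚ.m≤m+n y _) F⟶d))
      where
      -- suc (φ y) is definitionally suc k * suc y.
      φ : ℕ → ℕ
      φ y = y ℕ.+ k ℕ.* suc y

  fromℕ-∸ : ∀ {m n} → m ℕ.≤ n → fromℕ (n ℕ.∸ m) ≡ fromℕ n - fromℕ m
  fromℕ-∸ {m} {n} m≤n = begin
    fromℕ (n ℕ.∸ m)                     ≡⟨ solve 2 (λ x y → y := x :+ y :- x) refl (fromℕ m) (fromℕ (n ℕ.∸ m)) ⟩
    fromℕ m + fromℕ (n ℕ.∸ m) - fromℕ m ≡⟨ cong (_- fromℕ m) (fromℕ-+ m (n ℕ.∸ m)) ⟨
    fromℕ (m ℕ.+ (n ℕ.∸ m)) - fromℕ m   ≡⟨ cong (λ k → fromℕ k - fromℕ m) (ℕₚ.m+[n∸m]≡n m≤n) ⟩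
    fromℕ n - fromℕ m                   ∎
    where open ≡-Reasoning

  <⇔0<- : ∀ {x y} → y < x ⇔ 0ℚ < x - y
  <⇔0<- {x} {y} = mk⇔
    (λ y<x → subst (_< x - y) (+-inverseʳ y) (+-monoˡ-< (- y) y<x))
    (λ 0<x-y → subst₂ _<_ (+-identityˡ y) (solve 2 (λ x y → x :- y :+ y := x) refl x y) (+-monoˡ-< y 0<x-y))

  0<-transfer : ∀ {a b} u v .{{_ : Positive u}} .{{_ : Positive v}} → a * u ≡ b * v → 0ℚ < a → 0ℚ < b
  0<-transfer {a} {b} u v au≡bv 0<a = *-cancelʳ-<-nonNeg v {{pos⇒nonNeg v}}
    (subst₂ _<_ (trans (*-zeroˡ u) (sym (*-zeroˡ v))) au≡bv (*-monoˡ-<-pos u 0<a))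

  <-⇔-rescaled-difference : ∀ {x y z w} u v .{{_ : Positive u}} .{{_ : Positive v}} →
    (x - y) * u ≡ (z - w) * v → y < x ⇔ w < z
  <-⇔-rescaled-difference u v eq = mk⇔
    (λ y<x → Equivalence.from <⇔0<- (0<-transfer u v eq (Equivalence.to <⇔0<- y<x)))
    (λ w<z → Equivalence.from <⇔0<- (0<-transfer v u (sym eq) (Equivalence.to <⇔0<- w<z)))

  density-comparison : ∀ {a b c e P Q K} .{{_ : Positive P}} .{{_ : Positive Q}} → 0ℚ < e → .{{_ : NonZero e}} →
    K ≡ Q - P + 1ℚ → b * P ≡ e → a * Q * P + e ≡ e * P + c →
    (b < a ⇔ K < c ÷ e) × (c ÷ e < K → a < b)
  density-comparison {a} {b} {c} {e} {P} {Q} {K} 0<e K≡Q-P+1 bP≡e aQP+e≡eP+c =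
    <-⇔-rescaled-difference (Q * P) e [a-b]QP≡[t-K]e ,
    Equivalence.from (<-⇔-rescaled-difference (Q * P) e [b-a]QP≡[K-t]e)
    where
    instance
      _ = pos*pos⇒pos Q P
      _ = positive 0<e
    open ≡-Reasoning
    t : ℚ
    t = c ÷ e
    c≡te : c ≡ t * e
    c≡te = sym (trans (*-assoc c (1/ e) e) (trans (cong (c *_) (*-inverseˡ e)) (*-identityʳ c)))
    [a-b]QP≡[t-K]e : (a - b) * (Q * P) ≡ (t - K) * e
    [a-b]QP≡[t-K]e = begin
      (a - b) * (Q * P)               ≡⟨ solve 5 (λ a b e P Q → (a :- b) :* (Q :* P) := a :* Q :* P :+ e :- e :- b :* P :* Q) refl a b e P Q ⟩
      a * Q * P + e - e - b * P * Q   ≡⟨ cong₂ (λ u v → u - e - v * Q) aQP+e≡eP+c bP≡e ⟩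
      e * P + c - e - e * Q           ≡⟨ cong (λ u → e * P + u - e - e * Q) c≡te ⟩
      e * P + t * e - e - e * Q       ≡⟨ solve 4 (λ e P Q t → e :* P :+ t :* e :- e :- e :* Q := (t :- (Q :- P :+ con 1ℚ)) :* e) refl e P Q t ⟩
      (t - (Q - P + 1ℚ)) * e          ≡⟨ cong (λ k → (t - k) * e) K≡Q-P+1 ⟨
      (t - K) * e                     ∎
    [b-a]QP≡[K-t]e : (b - a) * (Q * P) ≡ (K - t) * e
    [b-a]QP≡[K-t]e = begin
      (b - a) * (Q * P)       ≡⟨ solve 3 (λ a b X → (b :- a) :* X := :- ((a :- b) :* X)) refl a b (Q * P) ⟩
      - ((a - b) * (Q * P))   ≡⟨ cong -_ [a-b]QP≡[t-K]e ⟩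
      - ((t - K) * e)         ≡⟨ solve 3 (λ t K e → :- ((t :- K) :* e) := (K :- t) :* e) refl t K e ⟩
      (K - t) * e             ∎

open import Data.Nat using (ℕ; zero; suc; _≤_; _∸_; _+_)
open import Data.Nat.Properties using (<⇒≤)
open import Data.Nat.Primality using (prime⇒nonZero)
open import Data.Integer using (+_)
open import Data.Rational using (ℚ; _/_; _÷_; NonZero) renaming (_<_ to _<ℚ_)
import Data.Rational as ℚ
open import Data.Product using (_×_; _,_)
open import Function.Bundles using (_⇔_)
open import Relation.Binary.PropositionalEquality using (_≡_; trans; cong)

open Counting using (module ConsecutivePrimes)
open Densities
  using (_⟶_; ratio; HasDensity⇒ratio⟶; ⟶-unique; ratio-cong; ratio-+; ratio-∘-*; fromℕ; fromℕ-pos; fromℕ-+; fromℕ-∸; density-comparison)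

lemma1 : (r i : ℕ) → 1 ≤ r → 1 ≤ i →
    (p q : ℕ) → IsNthPrime i p → IsNthPrime (suc i) q →
    (a b c e : ℚ) →
    HasDensity (kthPrimeDiv (suc r) q) a →
    HasDensity (kthPrimeDiv (suc r) p) b →
    HasDensity (exactlyAmongFirst (r ∸ 1) (i ∸ 1)) c →
    HasDensity (exactlyAmongFirst r (i ∸ 1)) e →
    (+ 0 / 1) <ℚ e → .{{_ : NonZero e}} →
    ((b <ℚ a) ⇔ ((+ ((q ∸ p) + 1) / 1) <ℚ (c ÷ e)))
    × ((c ÷ e) <ℚ (+ ((q ∸ p) + 1) / 1) → a <ℚ b)
lemma1 zero    _       ()  _  _ _ _ _ _ _ _ _ _ _ _ _ _
lemma1 (suc r) zero    _   () _ _ _ _ _ _ _ _ _ _ _ _ _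
lemma1 (suc r) (suc i) _   _  p q (p-prime , π[p]≡i) (q-prime , π[q]≡1+i) a b c e Ha Hb Hc He 0<e =
  density-comparison {{fromℕ-pos p}} {{fromℕ-pos q}} 0<e gap b*p≡e a*q*p+e≡e*p+c
  where
  open ConsecutivePrimes p-prime π[p]≡i q-prime π[q]≡1+i
  instance
    _ = prime⇒nonZero p-prime
    _ = prime⇒nonZero q-prime
  a-density : ratio (countUpTo (kthPrimeDiv (suc (suc r)) q)) ⟶ a
  a-density = HasDensity⇒ratio⟶ Ha
  b-density : ratio (countUpTo (kthPrimeDiv (suc (suc r)) p)) ⟶ b
  b-density = HasDensity⇒ratio⟶ Hb
  c-density : ratio (countUpTo (exactlyAmongFirst r i)) ⟶ c
  c-density = HasDensity⇒ratio⟶ Hc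
  e-density : ratio (countUpTo (exactlyAmongFirst (suc r) i)) ⟶ e
  e-density = HasDensity⇒ratio⟶ He
  gap : fromℕ (q ∸ p + 1) ≡ fromℕ q ℚ.- fromℕ p ℚ.+ ℚ.1ℚ
  gap = trans (fromℕ-+ (q ∸ p) 1) (cong (ℚ._+ ℚ.1ℚ) (fromℕ-∸ (<⇒≤ p<q)))
  b*p≡e : b ℚ.* fromℕ p ≡ e
  b*p≡e = ⟶-unique (ratio-cong (countUpTo-kthPrimeDiv-p (suc r)) (ratio-∘-* p b-density)) e-density
  a*q*p+e≡e*p+c : a ℚ.* fromℕ q ℚ.* fromℕ p ℚ.+ e ≡ e ℚ.* fromℕ p ℚ.+ c
  a*q*p+e≡e*p+c =
    ⟶-unique (ratio-cong (countUpTo-kthPrimeDiv-q r) (ratio-+ (ratio-∘-* p (ratio-∘-* q a-density)) e-density))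
             (ratio-+ (ratio-∘-* p e-density) c-density)
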